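{- Let $\pi$ be a nonempty partition diagram. Then $\pi$ can be written in the form $\pi = \pi^{(1)} \otimes \pi^{(2)} \otimes \cdots \otimes \pi^{(n)}$ with $n \in \mathbb{N}=\{1,2,\dots\}$ and $\pi^{(1)}, \ldots, \pi^{(n)}$ nonempty $\otimes$-irreducible partition diagrams, and this expression is unique (i.e., $n$ and the ordered tuple $(\pi^{(1)},\dots,\pi^{(n)})$ are uniquely determined by $\pi$).
   Context: For $k \geq 0$, a partition diagram of order $k$ is a set partition of $\{1,2,\ldots,k,1',2',\ldots,k'\}$; $A_k$ denotes the set of all such diagrams, and $A_0$ consists of the single empty diagram $\varnothing$. A diagram is nonempty if its order is at least $1$. For $\pi \in A_k$ and $\rho \in A_l$, the horizontal concatenation $\pi \otimes \rho \in A_{k+l}$ is the set partition whose blocks are the blocks of $\pi$ together with the blocks of $\rho$ in which every $i$ is replaced by $i+k$ and every $i'$ by $(i+k)'$. A partition diagram $\pi$ is $\otimes$-irreducible if it cannot be written as $\rho^{(1)} \otimes \rho^{(2)}$ with $\rho^{(1)}, \rho^{(2)}$ nonempty partition diagrams. -}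

module Defs where

open import Data.Nat using (ℕ; _+_; _≤_)
open import Data.Fin using (Fin; splitAt)
open import Data.Sum using (_⊎_; inj₁; inj₂)
import Data.Sum as Sum
open import Data.Bool using (Bool; true; false)
open import Data.Product using (Σ; _×_; _,_; ∃)
open import Data.List using (List; []; _∷_)
open import Data.List.NonEmpty using (List⁺; _∷_; toList)
open import Relation.Nullary using (¬_)
open import Relation.Binary.PropositionalEquality using (_≡_; refl; subst; sym)

-- Points of a diagram of order k: inj₁ i stands for i, inj₂ i stands for i'.
Pt : ℕ → Set
Pt k = Fin k ⊎ Fin k

-- A partition diagram of order k: a set partition of {1..k,1'..k'},
-- given by its (decidable) equivalence relation "lie in the same block".
record Diagram (k : ℕ) : Set where
  field
    rel     : Pt k → Pt k → Bool
    isRefl  : ∀ x → rel x x ≡ true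
    isSym   : ∀ x y → rel x y ≡ true → rel y x ≡ true
    isTrans : ∀ x y z → rel x y ≡ true → rel y z ≡ true → rel x z ≡ true
open Diagram public

_≈D_ : ∀ {k} → Diagram k → Diagram k → Set
π ≈D ρ = ∀ x y → rel π x y ≡ rel ρ x y

_≋_ : ∀ {k l} → Diagram k → Diagram l → Set
_≋_ {k} {l} π ρ = Σ (k ≡ l) (λ e → π ≈D subst Diagram (sym e) ρ)

side : ∀ {k l} → Pt (k + l) → Pt k ⊎ Pt l
side {k} (inj₁ i) = Sum.map inj₁ inj₁ (splitAt k i)
side {k} (inj₂ i) = Sum.map inj₂ inj₂ (splitAt k i)

module _ {k l : ℕ} (π : Diagram k) (ρ : Diagram l) where
  comb : Pt k ⊎ Pt l → Pt k ⊎ Pt l → Bool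
  comb (inj₁ a) (inj₁ b) = rel π a b
  comb (inj₂ a) (inj₂ b) = rel ρ a b
  comb (inj₁ _) (inj₂ _) = false
  comb (inj₂ _) (inj₁ _) = false

  comb-refl : ∀ x → comb x x ≡ true
  comb-refl (inj₁ a) = isRefl π a
  comb-refl (inj₂ a) = isRefl ρ a

  comb-sym : ∀ x y → comb x y ≡ true → comb y x ≡ true
  comb-sym (inj₁ a) (inj₁ b) p = isSym π a b p
  comb-sym (inj₂ a) (inj₂ b) p = isSym ρ a b p
  comb-sym (inj₁ _) (inj₂ _) ()
  comb-sym (inj₂ _) (inj₁ _) ()

  comb-trans : ∀ x y z → comb x y ≡ true → comb y z ≡ true → comb x z ≡ true
  comb-trans (inj₁ a) (inj₁ b) (inj₁ c) p q = isTrans π a b c p q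
  comb-trans (inj₂ a) (inj₂ b) (inj₂ c) p q = isTrans ρ a b c p q
  comb-trans (inj₁ _) (inj₁ _) (inj₂ _) p ()
  comb-trans (inj₁ _) (inj₂ _) _ () q
  comb-trans (inj₂ _) (inj₁ _) _ () q
  comb-trans (inj₂ _) (inj₂ _) (inj₁ _) p ()

  _⊗_ : Diagram (k + l)
  _⊗_ = record
    { rel     = λ x y → comb (side x) (side y)
    ; isRefl  = λ x → comb-refl (side x)
    ; isSym   = λ x y → comb-sym (side x) (side y)
    ; isTrans = λ x y z → comb-trans (side x) (side y) (side z)
    }

Irreducible : ∀ {k} → Diagram k → Set
Irreducible π =
  ¬ (Σ ℕ λ k₁ → Σ ℕ λ k₂ → Σ (Diagram k₁) λ ρ₁ → Σ (Diagram k₂) λ ρ₂ →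
       1 ≤ k₁ × 1 ≤ k₂ × (π ≋ (ρ₁ ⊗ ρ₂)))

AnyDiagram : Set
AnyDiagram = Σ ℕ Diagram

_≋A_ : AnyDiagram → AnyDiagram → Set
(_ , π) ≋A (_ , ρ) = π ≋ ρ

NonemptyIrreducible : AnyDiagram → Set
NonemptyIrreducible (k , π) = 1 ≤ k × Irreducible π

⨂' : AnyDiagram → List AnyDiagram → AnyDiagram
⨂' d [] = d
⨂' (k , π) (e ∷ es) with ⨂' e es
... | (l , ρ) = (k + l , π ⊗ ρ)

⨂ : List⁺ AnyDiagram → AnyDiagram
⨂ (d ∷ ds) = ⨂' d ds

{-# OPTIONS --safe #-}
module Submission where

-- Say π has a cut at j if no block of π contains both a point in a column < j and one in a
-- column ≥ j. Then π splits as (its first j columns) ⊗ (the rest), a concatenation has a cut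
-- at its seam, and π is ⊗-irreducible iff it has no cut strictly between 0 and its order.
-- Existence: cutting at the first positive cut leaves an irreducible left factor; recurse on
-- the right. Uniqueness: if two decompositions began with factors of different lengths, the
-- seam of the shorter one would be a proper cut of the longer, irreducible one.

open import Defs
open import Data.Nat using (ℕ; zero; suc; z≤n; s≤s; _+_; _≤_; _<_; _≤?_)
open import Data.Nat.Properties
open import Data.Nat.Induction using (<-rec)
open import Data.Fin using (toℕ; _↑ˡ_; _↑ʳ_; splitAt)
open import Data.Fin.Properties using (toℕ<n; toℕ-↑ˡ; toℕ-↑ʳ; splitAt-↑ˡ; splitAt-↑ʳ; splitAt⁻¹-↑ˡ; splitAt⁻¹-↑ʳ; all?)
open import Data.Sum as Sum using (inj₁; inj₂; [_,_])
open import Data.Bool using (true; false)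
import Data.Bool.Properties as Bool
open import Data.Product using (Σ; ∃; _×_; _,_; proj₁; proj₂)
open import Data.List using ([]; _∷_)
open import Data.List.NonEmpty using (List⁺; _∷_; _∷⁺_; toList)
open import Data.List.Relation.Unary.All using (All; []; _∷_)
open import Data.List.Relation.Binary.Pointwise using (Pointwise; []; _∷_)
open import Function using (_∘_)
open import Relation.Nullary using (¬_; Dec; yes; no; contradiction)
open import Relation.Nullary.Decidable using (map′; _×-dec_; _→-dec_)
open import Relation.Unary using (Pred; Decidable)
open import Relation.Binary.PropositionalEquality hiding ([_])

least : ∀ {p} {P : Pred ℕ p} → Decidable P → ∀ {n} → P n →
        ∃ λ m → m ≤ n × P m × (∀ {i} → i < m → ¬ P i)
least P? {zero} p = 0 , z≤n , p , λ ()
least P? {suc n} p with P? 0 | least (P? ∘ suc) p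
... | yes p₀ | _                   = 0 , z≤n , p₀ , λ ()
... | no ¬p₀ | m , m≤n , pm , below =
  suc m , s≤s m≤n , pm , λ { {zero} _ → ¬p₀ ; {suc i} (s≤s i<m) → below i<m }

m<m+n⇒0<n : ∀ m {n} → m < m + n → 1 ≤ n
m<m+n⇒0<n m {n} m<m+n = +-cancelˡ-< m 0 n (subst (_< m + n) (sym (+-identityʳ m)) m<m+n)

≋-refl : ∀ {k} {π : Diagram k} → π ≋ π
≋-refl = refl , λ _ _ → refl

≋-sym : ∀ {k l} {π : Diagram k} {ρ : Diagram l} → π ≋ ρ → ρ ≋ π
≋-sym (refl , f) = refl , λ x y → sym (f x y)

≋-trans : ∀ {k l m} {π : Diagram k} {ρ : Diagram l} {σ : Diagram m} → π ≋ ρ → ρ ≋ σ → π ≋ σ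
≋-trans (refl , f) (refl , g) = refl , λ x y → trans (f x y) (g x y)

≋⇒≈D : ∀ {k} {π ρ : Diagram k} → π ≋ ρ → π ≈D ρ
≋⇒≈D (refl , f) = f

rel-false-sym : ∀ {k} (π : Diagram k) {x y} → rel π x y ≡ false → rel π y x ≡ false
rel-false-sym π {x} {y} p with rel π y x in eq
... | false = refl
... | true  = contradiction (trans (sym (isSym π y x eq)) p) λ ()

restrict : ∀ {k a} → Diagram k → (Pt a → Pt k) → Diagram a
rel     (restrict π f) x y     = rel π (f x) (f y)
isRefl  (restrict π f) x       = isRefl π (f x)
isSym   (restrict π f) x y     = isSym π (f x) (f y)
isTrans (restrict π f) x y z   = isTrans π (f x) (f y) (f z)

column : ∀ {k} → Pt k → ℕ
column (inj₁ i) = toℕ i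
column (inj₂ i) = toℕ i

column< : ∀ {k} (x : Pt k) → column x < k
column< (inj₁ i) = toℕ<n i
column< (inj₂ i) = toℕ<n i

_⇑ˡ_ : ∀ {a} → Pt a → ∀ b → Pt (a + b)
x ⇑ˡ b = Sum.map (_↑ˡ b) (_↑ˡ b) x

_⇑ʳ_ : ∀ a {b} → Pt b → Pt (a + b)
a ⇑ʳ y = Sum.map (a ↑ʳ_) (a ↑ʳ_) y

column-⇑ˡ : ∀ {a} b (x : Pt a) → column (x ⇑ˡ b) ≡ column x
column-⇑ˡ b (inj₁ i) = toℕ-↑ˡ i b
column-⇑ˡ b (inj₂ i) = toℕ-↑ˡ i b

column-⇑ʳ : ∀ a {b} (y : Pt b) → column (a ⇑ʳ y) ≡ a + column y
column-⇑ʳ a (inj₁ i) = toℕ-↑ʳ a i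
column-⇑ʳ a (inj₂ i) = toℕ-↑ʳ a i

column-⇑ˡ< : ∀ {a} b (x : Pt a) → column (x ⇑ˡ b) < a
column-⇑ˡ< {a} b x = subst (_< a) (sym (column-⇑ˡ b x)) (column< x)

≤column-⇑ʳ : ∀ a {b} (y : Pt b) → a ≤ column (a ⇑ʳ y)
≤column-⇑ʳ a y = subst (a ≤_) (sym (column-⇑ʳ a y)) (m≤m+n a _)

side-⇑ˡ : ∀ {a} b (x : Pt a) → side (x ⇑ˡ b) ≡ inj₁ x
side-⇑ˡ {a} b (inj₁ i) rewrite splitAt-↑ˡ a i b = refl
side-⇑ˡ {a} b (inj₂ i) rewrite splitAt-↑ˡ a i b = refl

side-⇑ʳ : ∀ a {b} (y : Pt b) → side {a} (a ⇑ʳ y) ≡ inj₂ y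
side-⇑ʳ a {b} (inj₁ i) rewrite splitAt-↑ʳ a b i = refl
side-⇑ʳ a {b} (inj₂ i) rewrite splitAt-↑ʳ a b i = refl

data Sided (a b : ℕ) : Pt (a + b) → Set where
  onLeft  : (x : Pt a) → Sided a b (x ⇑ˡ b)
  onRight : (y : Pt b) → Sided a b (a ⇑ʳ y)

sided : ∀ a b (z : Pt (a + b)) → Sided a b z
sided a b (inj₁ i) with splitAt a i in eq
... | inj₁ j = subst (Sided a b) (cong inj₁ (splitAt⁻¹-↑ˡ eq)) (onLeft (inj₁ j))
... | inj₂ j = subst (Sided a b) (cong inj₁ (splitAt⁻¹-↑ʳ eq)) (onRight (inj₁ j))
sided a b (inj₂ i) with splitAt a i in eq
... | inj₁ j = subst (Sided a b) (cong inj₂ (splitAt⁻¹-↑ˡ eq)) (onLeft (inj₂ j))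
... | inj₂ j = subst (Sided a b) (cong inj₂ (splitAt⁻¹-↑ʳ eq)) (onRight (inj₂ j))

Cut : ∀ {k} → Diagram k → ℕ → Set
Cut π j = ∀ x y → column x < j → j ≤ column y → rel π x y ≡ false

cut? : ∀ {k} (π : Diagram k) j → Dec (Cut π j)
cut? π j = allPt? λ x → allPt? λ y →
  (column x <? j) →-dec ((j ≤? column y) →-dec (rel π x y Bool.≟ false))
  where
  allPt? : ∀ {k p} {P : Pred (Pt k) p} → Decidable P → Dec (∀ x → P x)
  allPt? P? = map′ (λ (p , q) → [ p , q ]) (λ p → p ∘ inj₁ , p ∘ inj₂)
                   (all? (P? ∘ inj₁) ×-dec all? (P? ∘ inj₂))

Cut-resp-≋ : ∀ {k l} {π : Diagram k} {ρ : Diagram l} {j} → π ≋ ρ → Cut ρ j → Cut π j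
Cut-resp-≋ (refl , f) c x y x<j j≤y = trans (f x y) (c x y x<j j≤y)

Cut-order : ∀ {k} (π : Diagram k) → Cut π k
Cut-order π x y _ k≤y = contradiction k≤y (<⇒≱ (column< y))

module _ {a b : ℕ} (X : Diagram a) (Y : Diagram b) where

  Cut-⊗⁺ˡ : ∀ {j} → Cut X j → j ≤ a → Cut (X ⊗ Y) j
  Cut-⊗⁺ˡ {j} c j≤a z w z<j j≤w with sided a b z | sided a b w
  ... | onLeft x  | onLeft y  = trans (cong₂ (comb X Y) (side-⇑ˡ b x) (side-⇑ˡ b y))
    (c x y (subst (_< j) (column-⇑ˡ b x) z<j) (subst (j ≤_) (column-⇑ˡ b y) j≤w))
  ... | onLeft x  | onRight y = cong₂ (comb X Y) (side-⇑ˡ b x) (side-⇑ʳ a y)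
  ... | onRight x | _         =
    contradiction (≤-trans j≤a (≤column-⇑ʳ a x)) (<⇒≱ z<j)

  Cut-⊗ : Cut (X ⊗ Y) a
  Cut-⊗ = Cut-⊗⁺ˡ (Cut-order X) ≤-refl

  Cut-⊗⁻ˡ : ∀ {j} → Cut (X ⊗ Y) j → Cut X j
  Cut-⊗⁻ˡ {j} c x y x<j j≤y = trans (sym (cong₂ (comb X Y) (side-⇑ˡ b x) (side-⇑ˡ b y)))
    (c (x ⇑ˡ b) (y ⇑ˡ b) (subst (_< j) (sym (column-⇑ˡ b x)) x<j) (subst (j ≤_) (sym (column-⇑ˡ b y)) j≤y))

module _ {a b : ℕ} (π : Diagram (a + b)) where
  private
    ρ₁ : Diagram a
    ρ₁ = restrict π (_⇑ˡ b)
    ρ₂ : Diagram b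
    ρ₂ = restrict π (a ⇑ʳ_)

  cut-split : Cut π a → π ≈D (ρ₁ ⊗ ρ₂)
  cut-split c z w with sided a b z | sided a b w
  ... | onLeft x  | onLeft y  = sym (cong₂ (comb ρ₁ ρ₂) (side-⇑ˡ b x) (side-⇑ˡ b y))
  ... | onLeft x  | onRight y =
    trans (c _ _ (column-⇑ˡ< b x) (≤column-⇑ʳ a y)) (sym (cong₂ (comb ρ₁ ρ₂) (side-⇑ˡ b x) (side-⇑ʳ a y)))
  ... | onRight y | onLeft x  =
    trans (rel-false-sym π (c _ _ (column-⇑ˡ< b x) (≤column-⇑ʳ a y))) (sym (cong₂ (comb ρ₁ ρ₂) (side-⇑ʳ a y) (side-⇑ˡ b x)))
  ... | onRight x | onRight y = sym (cong₂ (comb ρ₁ ρ₂) (side-⇑ʳ a x) (side-⇑ʳ a y))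

NoCutBelow : ∀ {k} → Diagram k → ℕ → Set
NoCutBelow π j = ∀ {i} → 1 ≤ i → i < j → ¬ Cut π i

irreducible⇒noProperCut : ∀ {k} (π : Diagram k) → Irreducible π → NoCutBelow π k
irreducible⇒noProperCut {k} π irr {j} 1≤j j<k c with m≤n⇒∃[o]m+o≡n (<⇒≤ j<k)
... | t , refl = irr (j , t , _ , _ , 1≤j , m<m+n⇒0<n j j<k , refl , cut-split π c)

noProperCut⇒irreducible : ∀ {k} (π : Diagram k) → NoCutBelow π k → Irreducible π
noProperCut⇒irreducible π none (k₁ , k₂ , σ₁ , σ₂ , 1≤k₁ , 1≤k₂ , π≋σ₁⊗σ₂@(refl , _)) =
  none 1≤k₁ (m<m+n k₁ 1≤k₂) (Cut-resp-≋ {π = π} {σ₁ ⊗ σ₂} π≋σ₁⊗σ₂ (Cut-⊗ σ₁ σ₂))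

firstCut : ∀ {k} (π : Diagram k) → 1 ≤ k → ∃ λ j → 1 ≤ j × j ≤ k × Cut π j × NoCutBelow π j
firstCut π 1≤k with least (λ j → (1 ≤? j) ×-dec cut? π j) (1≤k , Cut-order π)
... | j , j≤k , (1≤j , c) , below = j , 1≤j , j≤k , c , λ 1≤i i<j cᵢ → below i<j (1≤i , cᵢ)

left-of-firstCut-irreducible : ∀ {j t} (π : Diagram (j + t)) → Cut π j → NoCutBelow π j →
                               Irreducible (restrict π (_⇑ˡ t))
left-of-firstCut-irreducible {j} {t} π c none = noProperCut⇒irreducible ρ₁ λ 1≤i i<j cᵢ →
  none 1≤i i<j (Cut-resp-≋ {π = π} {ρ₁ ⊗ ρ₂} (refl , cut-split π c) (Cut-⊗⁺ˡ ρ₁ ρ₂ cᵢ (<⇒≤ i<j)))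
  where
  ρ₁ : Diagram j
  ρ₁ = restrict π (_⇑ˡ t)
  ρ₂ : Diagram t
  ρ₂ = restrict π (j ⇑ʳ_)

⊗-congʳ : ∀ {a b c} (X : Diagram a) {Y : Diagram b} {Z : Diagram c} → Y ≋ Z → (X ⊗ Y) ≋ (X ⊗ Z)
⊗-congʳ X {Y} {Z} (refl , f) = refl , λ z w → comb-congʳ (side z) (side w)
  where
  comb-congʳ : ∀ u v → comb X Y u v ≡ comb X Z u v
  comb-congʳ (inj₁ x) (inj₁ y) = refl
  comb-congʳ (inj₁ x) (inj₂ y) = refl
  comb-congʳ (inj₂ x) (inj₁ y) = refl
  comb-congʳ (inj₂ x) (inj₂ y) = f x y

Decomposition : AnyDiagram → Set
Decomposition π = Σ (List⁺ AnyDiagram) λ ds → All NonemptyIrreducible (toList ds) × ⨂ ds ≋A π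

decomposition-∷ : ∀ {j t} (π : Diagram (j + t)) → Cut π j → 1 ≤ j → NoCutBelow π j →
                  Decomposition (t , restrict π (j ⇑ʳ_)) → Decomposition (j + t , π)
decomposition-∷ {j} {t} π c 1≤j none (ds , ds-irr , ⨂ds≋ρ₂) =
  (j , ρ₁) ∷⁺ ds ,
  (1≤j , left-of-firstCut-irreducible π c none) ∷ ds-irr ,
  ≋-trans {π = ρ₁ ⊗ proj₂ (⨂ ds)} (⊗-congʳ ρ₁ ⨂ds≋ρ₂) (refl , λ z w → sym (cut-split π c z w))
  where
  ρ₁ : Diagram j
  ρ₁ = restrict π (_⇑ˡ t)

decompose : ∀ k → 1 ≤ k → (π : Diagram k) → Decomposition (k , π)
decompose = <-rec _ step
  where
  step : ∀ k → (∀ {t} → t < k → 1 ≤ t → (ρ : Diagram t) → Decomposition (t , ρ)) →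
         1 ≤ k → (π : Diagram k) → Decomposition (k , π)
  step k rec 1≤k π with firstCut π 1≤k
  ... | j , 1≤j , j≤k , c , none with m≤n⇒m<n∨m≡n j≤k
  ...   | inj₂ refl = (k , π) ∷ [] , (1≤k , noProperCut⇒irreducible π none) ∷ [] , ≋-refl
  ...   | inj₁ j<k with m≤n⇒∃[o]m+o≡n (<⇒≤ j<k)
  ...     | t , refl = decomposition-∷ π c 1≤j none
                         (rec (m<n+m t 1≤j) (m<m+n⇒0<n j j<k) (restrict π (j ⇑ʳ_)))

⊗-injective : ∀ {a b} {X X′ : Diagram a} {Y Y′ : Diagram b} → (X ⊗ Y) ≈D (X′ ⊗ Y′) → X ≈D X′ × Y ≈D Y′
⊗-injective {a} {b} {X} {X′} {Y} {Y′} h =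
  (λ x y → trans (sym (cong₂ (comb X Y) (side-⇑ˡ b x) (side-⇑ˡ b y)))
             (trans (h (x ⇑ˡ b) (y ⇑ˡ b)) (cong₂ (comb X′ Y′) (side-⇑ˡ b x) (side-⇑ˡ b y)))) ,
  (λ x y → trans (sym (cong₂ (comb X Y) (side-⇑ʳ a x) (side-⇑ʳ a y)))
             (trans (h (a ⇑ʳ x) (a ⇑ʳ y)) (cong₂ (comb X′ Y′) (side-⇑ʳ a x) (side-⇑ʳ a y))))

irreducible-prefix-≤ : ∀ {m r n s} (d : Diagram m) (D : Diagram r) (e : Diagram n) (E : Diagram s) →
                       1 ≤ m → Irreducible e → (d ⊗ D) ≋ (e ⊗ E) → n ≤ m
irreducible-prefix-≤ d D e E 1≤m e-irr h = ≮⇒≥ λ m<n →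
  irreducible⇒noProperCut e e-irr 1≤m m<n
    (Cut-⊗⁻ˡ e E (Cut-resp-≋ {π = e ⊗ E} {d ⊗ D} (≋-sym {π = d ⊗ D} h) (Cut-⊗ d D)))

_⊗A_ : AnyDiagram → AnyDiagram → AnyDiagram
d ⊗A e = proj₁ d + proj₁ e , proj₂ d ⊗ proj₂ e

⊗A-cancel : ∀ d D e E → NonemptyIrreducible d → NonemptyIrreducible e →
            (d ⊗A D) ≋A (e ⊗A E) → d ≋A e × D ≋A E
⊗A-cancel (m , d) (r , D) (n , e) (s , E) (1≤m , d-irr) (1≤n , e-irr) h
  with ≤-antisym (irreducible-prefix-≤ e E d D 1≤n d-irr (≋-sym {π = d ⊗ D} h))
                 (irreducible-prefix-≤ d D e E 1≤m e-irr h)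
... | refl with +-cancelˡ-≡ m r s (proj₁ h)
... | refl with ⊗-injective {X = d} {e} {D} {E} (≋⇒≈D {π = d ⊗ D} h)
... | d≈e , D≈E = (refl , d≈e) , (refl , D≈E)

⨂'-nonempty : ∀ d ds → 1 ≤ proj₁ d → 1 ≤ proj₁ (⨂' d ds)
⨂'-nonempty d []       1≤d = 1≤d
⨂'-nonempty d (e ∷ es) 1≤d = ≤-trans 1≤d (m≤m+n (proj₁ d) _)

⨂'-unique : ∀ d ds e es → All NonemptyIrreducible (d ∷ ds) → All NonemptyIrreducible (e ∷ es) →
            ⨂' d ds ≋A ⨂' e es → Pointwise _≋A_ (d ∷ ds) (e ∷ es)
⨂'-unique d [] e [] _ _ h = h ∷ []
⨂'-unique d [] e (e₂ ∷ es) ((_ , d-irr) ∷ []) ((1≤e , _) ∷ (1≤e₂ , _) ∷ _) h =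
  contradiction (_ , _ , proj₂ e , proj₂ (⨂' e₂ es) , 1≤e , ⨂'-nonempty e₂ es 1≤e₂ , h) d-irr
⨂'-unique d (d₂ ∷ ds) e [] ((1≤d , _) ∷ (1≤d₂ , _) ∷ _) ((_ , e-irr) ∷ []) h =
  contradiction (_ , _ , proj₂ d , proj₂ (⨂' d₂ ds) , 1≤d , ⨂'-nonempty d₂ ds 1≤d₂ , ≋-sym h) e-irr
-- h is accepted by ⊗A-cancel because ⨂' d (d₂ ∷ ds) is definitionally d ⊗A ⨂' d₂ ds.
⨂'-unique d (d₂ ∷ ds) e (e₂ ∷ es) (d-irr ∷ ds-irr) (e-irr ∷ es-irr) h
  with ⊗A-cancel d (⨂' d₂ ds) e (⨂' e₂ es) d-irr e-irr h
... | d≋e , rest = d≋e ∷ ⨂'-unique d₂ ds e₂ es ds-irr es-irr rest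

⨂-unique : ∀ {p} (ds es : List⁺ AnyDiagram) →
           All NonemptyIrreducible (toList ds) → ⨂ ds ≋A p →
           All NonemptyIrreducible (toList es) → ⨂ es ≋A p →
           Pointwise _≋A_ (toList ds) (toList es)
⨂-unique (d ∷ ds) (e ∷ es) ds-irr ⨂ds≋p es-irr ⨂es≋p =
  ⨂'-unique d ds e es ds-irr es-irr (≋-trans {π = proj₂ (⨂' d ds)} ⨂ds≋p (≋-sym {π = proj₂ (⨂' e es)} ⨂es≋p))

lemma2p4 : (k : ℕ) → 1 ≤ k → (π : Diagram k) →
    Σ (List⁺ AnyDiagram) (λ ds → All NonemptyIrreducible (toList ds) × (⨂ ds ≋A (k , π)))
    × ((ds es : List⁺ AnyDiagram) →
        All NonemptyIrreducible (toList ds) → ⨂ ds ≋A (k , π) →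
        All NonemptyIrreducible (toList es) → ⨂ es ≋A (k , π) →
        Pointwise _≋A_ (toList ds) (toList es))
lemma2p4 k 1≤k π = decompose k 1≤k π , ⨂-unique
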